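{- Let $n\ge 2$ and let $K_n=[k_{ij}]$ be the $n\times n$ tridiagonal matrix with $k_{22}=3$, $k_{ii}=1$ for $i\ne 2$, $k_{i+1,i}=1$ and $k_{i,i+1}=2$ for $1\le i\le n-1$, and all other entries $0$. Define $K_n^{(0)}=K_n$ and, for $1\le r\le n-2$, let $K_n^{(r)}$ be the contraction of $K_n^{(r-1)}$ on column $1$ relative to rows $1$ and $2$. Then $$\operatorname{per}K_n=\operatorname{per}K_n^{(n-2)}=j_n,$$ where $j_m$ denotes the $m$th Jacobsthal-Lucas number.
   Context: The Jacobsthal-Lucas numbers are defined by $j_0=2$, $j_1=1$, $j_{m+2}=j_{m+1}+2j_m$ for $m\ge 0$. The permanent of an $n\times n$ matrix $A=[a_{ij}]$ is $\operatorname{per}A=\sum_{\sigma\in S_n}\prod_{i=1}^n a_{i\sigma(i)}$. Contraction: if column $k$ of a matrix $A$ (with rows $r_1,\dots,r_m$) contains exactly two nonzero entries $a_{ik}$ and $a_{jk}$ ($i\ne j$), the contraction of $A$ on column $k$ relative to rows $i$ and $j$ is the $(m-1)\times(n-1)$ matrix obtained from $A$ by replacing row $i$ with $a_{jk}r_i+a_{ik}r_j$ and deleting row $j$ and column $k$. ($K_n$ is the adjacency matrix of a certain directed pseudo graph.) -}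

module Defs where

open import Data.Nat using (ℕ; zero; suc; _+_; _*_)
open import Data.Nat as ℕ using (_≡ᵇ_)
open import Data.Bool using (Bool; true; false; if_then_else_; _∧_; _∨_)
open import Data.Fin using (Fin; zero; suc; toℕ; _≟_)
open import Data.List using (List; []; _∷_; map; concatMap; allFin)
open import Data.List.Base using (all)
open import Data.Nat.ListAction using (sum; product)
import Data.Vec.Functional as VF
open import Relation.Nullary.Decidable using (⌊_⌋)

Mat : ℕ → ℕ → Set
Mat m n = Fin m → Fin n → ℕ

jl : ℕ → ℕ
jl zero = 2
jl (suc zero) = 1
jl (suc (suc m)) = jl (suc m) + 2 * jl m

allFuns : (m n : ℕ) → List (Fin m → Fin n)
allFuns zero n = (λ ()) ∷ []
allFuns (suc m) n = concatMap (λ f → map (λ a → a VF.∷ f) (allFin n)) (allFuns m n)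

isInjective : {n : ℕ} → (Fin n → Fin n) → Bool
isInjective {n} σ =
  all (λ i → all (λ k → (not' ⌊ σ i ≟ σ k ⌋) ∨ ⌊ i ≟ k ⌋) (allFin n)) (allFin n)
  where
  not' : Bool → Bool
  not' true = false
  not' false = true

per : {n : ℕ} → Mat n n → ℕ
per {n} A =
  sum (map (λ σ → if isInjective σ then product (map (λ i → A i (σ i)) (allFin n)) else 0)
           (allFuns n n))

-- The matrix K_n (paper's 1-based indices i,j correspond to toℕ i + 1, toℕ j + 1):
-- k_22 = 3, k_ii = 1 (i ≠ 2), k_{i+1,i} = 1, k_{i,i+1} = 2, all other entries 0.
K : (n : ℕ) → Mat n n
K n i j =
  if toℕ i ≡ᵇ toℕ j then (if toℕ i ≡ᵇ 1 then 3 else 1)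
  else if toℕ i ≡ᵇ suc (toℕ j) then 1
  else if toℕ j ≡ᵇ suc (toℕ i) then 2
  else 0

-- Contraction on column 1 relative to rows 1 and 2 (paper's 1-based indexing):
-- row 1 is replaced by a_{21} r_1 + a_{11} r_2, then row 2 and column 1 are deleted.
-- (On a 1×1 matrix there is no row 2; the result is then the empty matrix. This case
-- is never used in the theorem.)
contract : {k : ℕ} → Mat (suc k) (suc k) → Mat k k
contract {zero} A ()
contract {suc k} A zero j = A (suc zero) zero * A zero (suc j) + A zero zero * A (suc zero) (suc j)
contract {suc k} A (suc i) j = A (suc (suc i)) (suc j)

contractIter : (r m : ℕ) → Mat (r + m) (r + m) → Mat m m
contractIter zero m A = A
contractIter (suc r) m A = contractIter r m (contract A)

{-# OPTIONS --safe #-}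
-- Expanding the permanent along its first row, which is derived from the sum over permutations, shows that
-- contracting on a column whose nonzero entries lie in the first two rows preserves the permanent: after the
-- first-row expansion, each minor that deletes a column c ≥ 2 has the single nonzero entry a₂₁ in its first
-- column, and regrouping the terms gives the first-row expansion of the contraction. Every contraction of K_n
-- has first column (x, 1, 0, …, 0); the s-th one has first row (j_{s+1}, 2 j_s, 0, …) and agrees with K_n
-- shifted by s below it. Hence per K_n = per K_n^(n-2), and the permanent of that 2×2 matrix is the corner entry
-- of one more contraction, j_n.
module Submission where

open import Defs
open import Data.Nat.Properties using (+-*-semiring)
open import Algebra.Properties.Semiring.Sum +-*-semiring
  using (sum-syntax; sum-remove; ∑-distrib-+; *-distribˡ-sum; sum-cong-≗; sum-replicate-zero)
open import Data.Bool using (Bool; true; false; T; T?; not; _∧_; if_then_else_)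
open import Data.Bool.Properties using (T-≡)
open import Data.Empty using (⊥-elim)
open import Data.Fin using (Fin; zero; suc; toℕ; punchIn; punchOut; _≟_)
open import Data.Fin.Properties using (punchIn-injective; punchInᵢ≢i; punchIn-punchOut)
import Data.Fin.Properties as Fin
open import Data.List using (List; []; _∷_; _++_; map; concatMap; allFin)
open import Data.List.Membership.Propositional.Properties using (∈-allFin)
open import Data.List.Properties using (map-++; map-cong; map-∘; map-tabulate)
import Data.List.Relation.Unary.All as All
open import Data.List.Relation.Unary.All.Properties using (all⁺; all⁻; ¬All⇒Any¬)
open import Data.List.Relation.Unary.Any using (satisfied)
open import Data.Nat as ℕ using (ℕ; zero; suc; _+_; _*_)
open import Data.Nat.ListAction using (sum; product)
open import Data.Nat.ListAction.Properties using (sum-++)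
open import Data.Nat.Properties
  using (*-zeroʳ; *-identityˡ; *-identityʳ; *-comm; *-distribˡ-+; +-identityʳ; +-comm; +-suc;
         +-cancelˡ-≡; suc-injective; m+1+n≢0)
open import Data.Nat.Tactic.RingSolver using (solve-∀)
open import Data.Product using (∃₂; _×_; _,_; proj₁; proj₂)
open import Data.Unit using (tt)
open import Data.Vec.Functional as Vec using (removeAt)
open import Function using (_∘_; mk⇔; Equivalence)
open import Function.Definitions using (Injective)
open import Relation.Binary.PropositionalEquality
open import Relation.Nullary using (¬_; yes; no; does; contradiction)
open import Relation.Nullary.Decidable using (dec-true; dec-false; does-⇔; decidable-stable)

sum-map-concatMap : ∀ {A B : Set} (h : B → ℕ) (g : A → List B) xs →
                    sum (map h (concatMap g xs)) ≡ sum (map (λ x → sum (map h (g x))) xs)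
sum-map-concatMap h g []       = refl
sum-map-concatMap h g (x ∷ xs) = begin
  sum (map h (g x ++ concatMap g xs))               ≡⟨ cong sum (map-++ h (g x) _) ⟩
  sum (map h (g x) ++ map h (concatMap g xs))       ≡⟨ sum-++ (map h (g x)) _ ⟩
  sum (map h (g x)) + sum (map h (concatMap g xs))  ≡⟨ cong (sum (map h (g x)) +_) (sum-map-concatMap h g xs) ⟩
  sum (map h (g x)) + sum (map (λ y → sum (map h (g y))) xs) ∎
  where open ≡-Reasoning

map-allFin-suc : ∀ {A : Set} n (g : Fin (suc n) → A) → map g (allFin (suc n)) ≡ g zero ∷ map (g ∘ suc) (allFin n)
map-allFin-suc n g = cong (g zero ∷_) (trans (map-tabulate suc g) (sym (map-tabulate (λ i → i) (g ∘ suc))))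

sum-map-allFin : ∀ n (h : Fin n → ℕ) → sum (map h (allFin n)) ≡ ∑[ i < n ] h i
sum-map-allFin zero    h = refl
sum-map-allFin (suc n) h = trans (cong sum (map-allFin-suc n h)) (cong (h zero +_) (sum-map-allFin n (h ∘ suc)))

sum-map-∑ : ∀ {A : Set} {n} xs (F : A → Fin n → ℕ) →
            sum (map (λ x → ∑[ i < n ] F x i) xs) ≡ ∑[ i < n ] sum (map (λ x → F x i) xs)
sum-map-∑ {n = n} []       F = sym (sum-replicate-zero n)
sum-map-∑         (x ∷ xs) F = trans (cong (_ +_) (sum-map-∑ xs F)) (sym (∑-distrib-+ (F x) _))

sum-map-*ˡ : ∀ {A : Set} c (h : A → ℕ) xs → sum (map (λ x → c * h x) xs) ≡ c * sum (map h xs)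
sum-map-*ˡ c h []       = sym (*-zeroʳ c)
sum-map-*ˡ c h (x ∷ xs) = trans (cong (c * h x +_) (sum-map-*ˡ c h xs)) (sym (*-distribˡ-+ c (h x) _))

-- The pair test inside isInjective uses a negation local to Defs, which cannot be named here; the pairwise
-- facts are therefore reached by with-abstraction on the decisions σ i ≟ σ k and i ≟ k.
isInjective⇒injective : ∀ {n} {σ : Fin n → Fin n} → T (isInjective σ) → Injective _≡_ _≡_ σ
isInjective⇒injective {n} {σ} t {i} {k} σi≡σk
  with σ i ≟ σ k | i ≟ k
     | All.lookup (all⁺ _ (allFin n) (All.lookup (all⁺ _ (allFin n) t) (∈-allFin i))) (∈-allFin k)
... | _        | yes i≡k | _ = i≡k
... | no σi≢σk | no _    | _ = contradiction σi≡σk σi≢σk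
... | yes _    | no _    | ()

nonInjectivePair : ∀ {n} {σ : Fin n → Fin n} → ¬ T (isInjective σ) → ∃₂ λ i k → σ i ≡ σ k × i ≢ k
nonInjectivePair {n} {σ} ¬t with satisfied (¬All⇒Any¬ (T? ∘ _) (allFin n) (¬t ∘ all⁻ _ {xs = allFin n}))
... | i , ¬tᵢ with satisfied (¬All⇒Any¬ (T? ∘ _) (allFin n) (¬tᵢ ∘ all⁻ _ {xs = allFin n}))
... | k , ¬tᵢₖ with σ i ≟ σ k | i ≟ k
... | yes σi≡σk | no i≢k = i , k , σi≡σk , i≢k
... | yes _     | yes _  = ⊥-elim (¬tᵢₖ tt)
... | no _      | _      = ⊥-elim (¬tᵢₖ tt)

injective⇒isInjective : ∀ {n} {σ : Fin n → Fin n} → Injective _≡_ _≡_ σ → T (isInjective σ)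
injective⇒isInjective {σ = σ} inj = decidable-stable (T? (isInjective σ)) λ ¬t →
  let i , k , σi≡σk , i≢k = nonInjectivePair ¬t in i≢k (inj σi≡σk)

_∖_ : ∀ {n} → (Fin n → Bool) → Fin n → Fin n → Bool
(P ∖ j) k = P k ∧ not (does (k ≟ j))

∖-sound : ∀ {n} {P : Fin n → Bool} {j k} → T ((P ∖ j) k) → T (P k) × k ≢ j
∖-sound {P = P} {j = j} {k = k} t with P k | k ≟ j
... | true | no k≢j = tt , k≢j

∖-complete : ∀ {n} {P : Fin n → Bool} {j k} → T (P k) → k ≢ j → T ((P ∖ j) k)
∖-complete {P = P} {j = j} {k = k} Pk k≢j with P k | k ≟ j
... | true | no _    = tt
... | true | yes k≡j = k≢j k≡j

∖-punchIn : ∀ {n} (P : Fin (suc n) → Bool) j c d → (P ∖ punchIn j c) (punchIn j d) ≡ (removeAt P j ∖ c) d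
∖-punchIn P j c d = cong (λ b → P (punchIn j d) ∧ not b)
  (does-⇔ (mk⇔ (punchIn-injective j d c) (cong (punchIn j))) (punchIn j d ≟ punchIn j c) (d ≟ c))

-- perOn P A sums ∏ A i (f i) over the injective f : Fin m → Fin n with image in P.
perOn : ∀ {m n} → (Fin n → Bool) → Mat m n → ℕ
perOn {zero}      P A = 1
perOn {suc m} {n} P A = ∑[ j < n ] ((if P j then A zero j else 0) * perOn (P ∖ j) (A ∘ suc))

perOn-cong : ∀ {m n} {P Q : Fin n → Bool} (A : Mat m n) → (∀ j → P j ≡ Q j) → perOn P A ≡ perOn Q A
perOn-cong {zero}  A P≗Q = refl
perOn-cong {suc m} A P≗Q = sum-cong-≗ λ j →
  cong₂ (λ b x → (if b then A zero j else 0) * x) (P≗Q j)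
        (perOn-cong (A ∘ suc) λ k → cong (_∧ _) (P≗Q k))

perOn-removeColumn : ∀ {m n} {P : Fin (suc n) → Bool} (A : Mat m (suc n)) j → P j ≡ false →
                     perOn P A ≡ perOn (removeAt P j) (λ i → removeAt (A i) j)
perOn-removeColumn {zero}          A j Pj≡false = refl
perOn-removeColumn {suc m} {n} {P} A j Pj≡false = begin
  perOn P A
    ≡⟨ sum-remove {i = j} term ⟩
  term j + ∑[ c < n ] term (punchIn j c)
    ≡⟨ cong (λ b → (if b then A zero j else 0) * rest j + ∑[ c < n ] term (punchIn j c)) Pj≡false ⟩
  ∑[ c < n ] term (punchIn j c)
    ≡⟨ sum-cong-≗ (λ c → cong (coefficient (punchIn j c) *_) (removed c)) ⟩
  perOn (removeAt P j) (λ i → removeAt (A i) j) ∎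
  where
  open ≡-Reasoning
  coefficient rest term : Fin (suc n) → ℕ
  coefficient l = if P l then A zero l else 0
  rest l = perOn (P ∖ l) (A ∘ suc)
  term l = coefficient l * rest l
  removed : ∀ c → rest (punchIn j c) ≡ perOn (removeAt P j ∖ c) (λ i → removeAt (A (suc i)) j)
  removed c = trans (perOn-removeColumn (A ∘ suc) j (cong (_∧ _) Pj≡false))
                    (perOn-cong (λ i → removeAt (A (suc i)) j) (∖-punchIn P j c))

termOn : ∀ {m n} → (Fin n → Bool) → Mat m n → (Fin m → Fin n) → ℕ
termOn {zero}  P A f = 1
termOn {suc m} P A f = (if P (f zero) then A zero (f zero) else 0) * termOn (P ∖ f zero) (A ∘ suc) (f ∘ suc)

sum-map-termOn : ∀ {m n} (P : Fin n → Bool) (A : Mat m n) → sum (map (termOn P A) (allFuns m n)) ≡ perOn P A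
sum-map-termOn {zero}      P A = refl
sum-map-termOn {suc m} {n} P A = begin
  sum (map (termOn P A) (concatMap (λ f → map (Vec._∷ f) (allFin n)) (allFuns m n)))
    ≡⟨ sum-map-concatMap _ _ (allFuns m n) ⟩
  sum (map (λ f → sum (map (termOn P A) (map (Vec._∷ f) (allFin n)))) (allFuns m n))
    ≡⟨ cong sum (map-cong (λ f → trans (cong sum (sym (map-∘ (allFin n)))) (sum-map-allFin n _)) (allFuns m n)) ⟩
  sum (map (λ f → ∑[ a < n ] termOn P A (a Vec.∷ f)) (allFuns m n))
    ≡⟨ sum-map-∑ (allFuns m n) (λ f a → termOn P A (a Vec.∷ f)) ⟩
  ∑[ a < n ] sum (map (λ f → coefficient a * termOn (P ∖ a) (A ∘ suc) f) (allFuns m n))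
    ≡⟨ sum-cong-≗ (λ a → trans (sum-map-*ˡ (coefficient a) _ (allFuns m n))
                              (cong (coefficient a *_) (sum-map-termOn (P ∖ a) (A ∘ suc)))) ⟩
  perOn P A ∎
  where
  open ≡-Reasoning
  coefficient : Fin n → ℕ
  coefficient a = if P a then A zero a else 0

Fits : ∀ {m n} → (Fin n → Bool) → (Fin m → Fin n) → Set
Fits P f = (∀ i → T (P (f i))) × Injective _≡_ _≡_ f

fits-tail : ∀ {m n} {P : Fin n → Bool} {f : Fin (suc m) → Fin n} → Fits P f → Fits (P ∖ f zero) (f ∘ suc)
fits-tail {P = P} (inP , inj) = (λ i → ∖-complete {P = P} (inP (suc i)) (Fin.0≢1+n ∘ sym ∘ inj))
                              , Fin.suc-injective ∘ inj

fits-cons : ∀ {m n} {P : Fin n → Bool} {f : Fin (suc m) → Fin n} →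
            T (P (f zero)) → Fits (P ∖ f zero) (f ∘ suc) → Fits P f
fits-cons {P = P} {f} Pf₀ (inP , inj) = inP′ , inj′
  where
  inP′ : ∀ i → T (P (f i))
  inP′ zero    = Pf₀
  inP′ (suc i) = proj₁ (∖-sound {P = P} (inP i))
  inj′ : Injective _≡_ _≡_ f
  inj′ {zero}  {zero}  _ = refl
  inj′ {zero}  {suc k} e = contradiction (sym e) (proj₂ (∖-sound {P = P} (inP k)))
  inj′ {suc i} {zero}  e = contradiction e (proj₂ (∖-sound {P = P} (inP i)))
  inj′ {suc i} {suc k} e = cong suc (inj e)

termOn-fits : ∀ {m n} {P : Fin n → Bool} (A : Mat m n) {f : Fin m → Fin n} →
              Fits P f → termOn P A f ≡ product (map (λ i → A i (f i)) (allFin m))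
termOn-fits {zero}                  A     fits = refl
termOn-fits {suc m} {P = P} A {f} fits with P (f zero) | proj₁ fits zero
... | true | _ = trans (cong (A zero (f zero) *_) (termOn-fits (A ∘ suc) (fits-tail {P = P} fits)))
                       (sym (cong product (map-allFin-suc m (λ i → A i (f i)))))

termOn-unfit : ∀ {m n} {P : Fin n → Bool} (A : Mat m n) {f : Fin m → Fin n} → ¬ Fits P f → termOn P A f ≡ 0
termOn-unfit {zero}             A     unfit = ⊥-elim (unfit ((λ ()) , λ { {()} }))
termOn-unfit {suc m} {P = P} A {f} unfit with P (f zero) in Pf₀
... | false = refl
... | true  = trans (cong (A zero (f zero) *_)
                      (termOn-unfit (A ∘ suc) λ fits → unfit (fits-cons {P = P} (Equivalence.from T-≡ Pf₀) fits)))
                    (*-zeroʳ (A zero (f zero)))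

permanentTerm≡termOn : ∀ {n} (A : Mat n n) σ →
  (if isInjective σ then product (map (λ i → A i (σ i)) (allFin n)) else 0) ≡ termOn (λ _ → true) A σ
permanentTerm≡termOn A σ with isInjective σ | isInjective⇒injective {σ = σ} | injective⇒isInjective {σ = σ}
... | true  | inj | _    = sym (termOn-fits A ((λ _ → tt) , inj tt))
... | false | _   | ¬inj = sym (termOn-unfit A (¬inj ∘ proj₂))

per≡perOn : ∀ {n} (A : Mat n n) → per A ≡ perOn (λ _ → true) A
per≡perOn {n} A = trans (cong sum (map-cong (permanentTerm≡termOn A) (allFuns n n))) (sum-map-termOn _ A)

minor : ∀ {n} → Fin (suc n) → Mat (suc n) (suc n) → Mat n n
minor j A i = removeAt (A (suc i)) j

per-expand : ∀ {n} (A : Mat (suc n) (suc n)) → per A ≡ ∑[ j < suc n ] (A zero j * per (minor j A))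
per-expand A = trans (per≡perOn A) (sum-cong-≗ λ j → cong (A zero j *_) (minorTerm j))
  where
  minorTerm : ∀ j → perOn ((λ _ → true) ∖ j) (A ∘ suc) ≡ per (minor j A)
  minorTerm j = begin
    perOn ((λ _ → true) ∖ j) (A ∘ suc)
      ≡⟨ perOn-removeColumn (A ∘ suc) j (cong not (dec-true (j ≟ j) refl)) ⟩
    perOn (removeAt ((λ _ → true) ∖ j) j) (minor j A)
      ≡⟨ perOn-cong (minor j A) (λ c → cong not (dec-false (punchIn j c ≟ j) (punchInᵢ≢i j c))) ⟩
    perOn (λ _ → true) (minor j A)
      ≡⟨ per≡perOn (minor j A) ⟨
    per (minor j A) ∎
    where open ≡-Reasoning

per-minor-zeroColumn : ∀ {n} (A : Mat (suc n) (suc n)) {j l} → l ≢ j → (∀ i → A (suc i) j ≡ 0) →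
                       per (minor l A) ≡ 0

per-zeroColumn : ∀ {n} (A : Mat n n) c → (∀ i → A i c ≡ 0) → per A ≡ 0
per-zeroColumn {suc n} A c col≡0 = begin
  per A                                       ≡⟨ per-expand A ⟩
  ∑[ j < suc n ] (A zero j * per (minor j A)) ≡⟨ sum-cong-≗ term≡0 ⟩
  ∑[ j < suc n ] 0                            ≡⟨ sum-replicate-zero (suc n) ⟩
  0                                           ∎
  where
  open ≡-Reasoning
  term≡0 : ∀ j → A zero j * per (minor j A) ≡ 0
  term≡0 j with j ≟ c
  ... | yes j≡c = cong (_* per (minor j A)) (trans (cong (A zero) j≡c) (col≡0 zero))
  ... | no j≢c  = trans (cong (A zero j *_) (per-minor-zeroColumn A j≢c (col≡0 ∘ suc))) (*-zeroʳ (A zero j))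

per-minor-zeroColumn A {l = l} l≢j col≡0 = per-zeroColumn (minor l A) (punchOut l≢j) λ i →
  trans (cong (A (suc i)) (punchIn-punchOut l≢j)) (col≡0 i)

per-singleEntryColumn : ∀ {n} (A : Mat (suc n) (suc n)) j → (∀ i → A (suc i) j ≡ 0) →
                        per A ≡ A zero j * per (minor j A)
per-singleEntryColumn {n} A j col≡0 = begin
  per A                                  ≡⟨ per-expand A ⟩
  ∑[ l < suc n ] term l                  ≡⟨ sum-remove {i = j} term ⟩
  term j + ∑[ c < n ] term (punchIn j c) ≡⟨ cong (term j +_) (trans (sum-cong-≗ term≡0) (sum-replicate-zero n)) ⟩
  term j + 0                             ≡⟨ +-identityʳ (term j) ⟩
  term j                                 ∎
  where
  open ≡-Reasoning
  term : Fin (suc n) → ℕ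
  term l = A zero l * per (minor l A)
  term≡0 : ∀ c → term (punchIn j c) ≡ 0
  term≡0 c = trans (cong (A zero (punchIn j c) *_) (per-minor-zeroColumn A (punchInᵢ≢i j c) col≡0))
                   (*-zeroʳ (A zero (punchIn j c)))

per-1×1 : (A : Mat 1 1) → per A ≡ A zero zero
per-1×1 A = trans (per-singleEntryColumn A zero (λ ())) (*-identityʳ (A zero zero))

per-contract : ∀ {k} (A : Mat (suc (suc k)) (suc (suc k))) → (∀ i → A (suc (suc i)) zero ≡ 0) →
               per A ≡ per (contract A)
per-contract {k} A col≡0 = begin
  per A
    ≡⟨ per-expand A ⟩
  a₀₀ * per (minor zero A) + ∑[ c < suc k ] (a₀ c * per (minor (suc c) A))
    ≡⟨ cong₂ _+_ (cong (a₀₀ *_) (per-expand (minor zero A)))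
                 (sum-cong-≗ λ c → cong (a₀ c *_) (per-singleEntryColumn (minor (suc c) A) zero col≡0)) ⟩
  a₀₀ * ∑[ c < suc k ] (a₁ c * D c) + ∑[ c < suc k ] (a₀ c * (a₁₀ * D c))
    ≡⟨ cong (_+ ∑[ c < suc k ] (a₀ c * (a₁₀ * D c))) (*-distribˡ-sum a₀₀ (λ c → a₁ c * D c)) ⟩
  ∑[ c < suc k ] (a₀₀ * (a₁ c * D c)) + ∑[ c < suc k ] (a₀ c * (a₁₀ * D c))
    ≡⟨ ∑-distrib-+ (λ c → a₀₀ * (a₁ c * D c)) (λ c → a₀ c * (a₁₀ * D c)) ⟨
  ∑[ c < suc k ] (a₀₀ * (a₁ c * D c) + a₀ c * (a₁₀ * D c))
    ≡⟨ sum-cong-≗ (λ c → regroup a₀₀ a₁₀ (a₀ c) (a₁ c) (D c)) ⟩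
  ∑[ c < suc k ] ((a₁₀ * a₀ c + a₀₀ * a₁ c) * D c)
    ≡⟨ per-expand (contract A) ⟨
  per (contract A) ∎
  where
  open ≡-Reasoning
  a₀₀ a₁₀ : ℕ
  a₀₀ = A zero zero
  a₁₀ = A (suc zero) zero
  a₀ a₁ D : Fin (suc k) → ℕ
  a₀ c = A zero (suc c)
  a₁ c = A (suc zero) (suc c)
  D c = per (minor c (contract A))
  regroup : ∀ a b x y d → a * (y * d) + x * (b * d) ≡ (b * x + a * y) * d
  regroup = solve-∀

kOffDiagonal : ℕ → ℕ → ℕ
kOffDiagonal x y = if x ℕ.≡ᵇ suc y then 1 else if y ℕ.≡ᵇ suc x then 2 else 0

-- K n i j reduces to kEntry (toℕ i) (toℕ j).
kEntry : ℕ → ℕ → ℕ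
kEntry x y = if x ℕ.≡ᵇ y then (if x ℕ.≡ᵇ 1 then 3 else 1) else kOffDiagonal x y

kEntry-offDiagonal : ∀ {x y} → x ≢ y → kEntry x y ≡ kOffDiagonal x y
kEntry-offDiagonal {x} {y} x≢y =
  cong (λ b → if b then (if x ℕ.≡ᵇ 1 then 3 else 1) else kOffDiagonal x y) (dec-false (x ℕ.≟ y) x≢y)

kEntry-diagonal : ∀ {x} → x ≢ 1 → kEntry x x ≡ 1
kEntry-diagonal {x} x≢1 =
  trans (cong (λ b → if b then (if x ℕ.≡ᵇ 1 then 3 else 1) else kOffDiagonal x x) (dec-true (x ℕ.≟ x) refl))
        (cong (λ b → if b then 3 else 1) (dec-false (x ℕ.≟ 1) x≢1))

kEntry-+ : ∀ s {x y} → x ≢ y → kEntry (s + x) (s + y) ≡ kEntry x y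
kEntry-+ zero            x≢y = refl
kEntry-+ (suc s) {x} {y} x≢y =
  trans (kEntry-offDiagonal (s+x≢s+y ∘ suc-injective)) (trans (sym (kEntry-offDiagonal s+x≢s+y)) (kEntry-+ s x≢y))
  where
  s+x≢s+y : s + x ≢ s + y
  s+x≢s+y = x≢y ∘ +-cancelˡ-≡ s x y

HasEntries : ∀ {n} → Mat n n → (ℕ → ℕ → ℕ) → Set
HasEntries A F = ∀ i j → A i j ≡ F (toℕ i) (toℕ j)

contractℕ : (ℕ → ℕ → ℕ) → ℕ → ℕ → ℕ
contractℕ F zero    y = F 1 0 * F 0 (suc y) + F 0 0 * F 1 (suc y)
contractℕ F (suc x) y = F (suc (suc x)) (suc y)

contract-entries : ∀ {k} {A : Mat (suc k) (suc k)} {F} → HasEntries A F → HasEntries (contract A) (contractℕ F)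
contract-entries {suc k} A≡F zero    j = cong₂ _+_ (cong₂ _*_ (A≡F (suc zero) zero) (A≡F zero (suc j)))
                                                   (cong₂ _*_ (A≡F zero zero) (A≡F (suc zero) (suc j)))
contract-entries {suc k} A≡F (suc i) j = A≡F (suc (suc i)) (suc j)

-- Entries of the s-th contraction of K, 0-based: first row (j_{s+1}, 2 j_s, 0, …), except that its entry 2 at
-- s = 0 is not 2 j_0; the other rows are those of K shifted by s along the diagonal.
Kᶜ : ℕ → ℕ → ℕ → ℕ
Kᶜ s       zero    zero          = jl (suc s)
Kᶜ s       zero    (suc (suc y)) = 0
Kᶜ zero    zero    (suc zero)    = 2
Kᶜ (suc s) zero    (suc zero)    = 2 * jl (suc s)
Kᶜ s       (suc x) y             = kEntry (s + suc x) (s + y)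

K-entries : ∀ n → HasEntries (K n) (Kᶜ 0)
K-entries n i j = kEntry≡Kᶜ₀ (toℕ i) (toℕ j)
  where
  kEntry≡Kᶜ₀ : ∀ x y → kEntry x y ≡ Kᶜ 0 x y
  kEntry≡Kᶜ₀ zero    zero          = refl
  kEntry≡Kᶜ₀ zero    (suc zero)    = refl
  kEntry≡Kᶜ₀ zero    (suc (suc y)) = refl
  kEntry≡Kᶜ₀ (suc x) y             = refl

Kᶜ-contract : ∀ s x y → contractℕ (Kᶜ s) x y ≡ Kᶜ (suc s) x y
Kᶜ-contract zero    zero zero = refl
Kᶜ-contract (suc s) zero zero = begin
  kEntry (suc s + 1) (suc s + 0) * (2 * jl (suc s)) + jl (suc (suc s)) * kEntry (suc s + 1) (suc s + 1)
    ≡⟨ cong₂ (λ a b → a * (2 * jl (suc s)) + jl (suc (suc s)) * b)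
             (kEntry-+ (suc s) (λ ())) (kEntry-diagonal (m+1+n≢0 s ∘ suc-injective)) ⟩
  1 * (2 * jl (suc s)) + jl (suc (suc s)) * 1
    ≡⟨ cong₂ _+_ (*-identityˡ (2 * jl (suc s))) (*-identityʳ (jl (suc (suc s)))) ⟩
  2 * jl (suc s) + jl (suc (suc s))
    ≡⟨ +-comm (2 * jl (suc s)) (jl (suc (suc s))) ⟩
  jl (suc (suc (suc s))) ∎
  where open ≡-Reasoning
Kᶜ-contract s zero (suc zero) =
  cong₂ _+_ (*-zeroʳ (kEntry (s + 1) (s + 0)))
            (trans (cong (jl (suc s) *_) (kEntry-+ s (λ ()))) (*-comm (jl (suc s)) 2))
Kᶜ-contract s zero (suc (suc y)) =
  cong₂ _+_ (*-zeroʳ (kEntry (s + 1) (s + 0)))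
            (trans (cong (jl (suc s) *_) (kEntry-+ s (λ ()))) (*-zeroʳ (jl (suc s))))
Kᶜ-contract s (suc x) y = cong₂ kEntry (+-suc s (suc x)) (+-suc s y)

contract-Kᶜ : ∀ {k s} {A : Mat (suc k) (suc k)} → HasEntries A (Kᶜ s) → HasEntries (contract A) (Kᶜ (suc s))
contract-Kᶜ {s = s} A≡K i j = trans (contract-entries A≡K i j) (Kᶜ-contract s (toℕ i) (toℕ j))

contractIter-Kᶜ : ∀ r {m s} (A : Mat (r + m) (r + m)) → HasEntries A (Kᶜ s) →
                  HasEntries (contractIter r m A) (Kᶜ (r + s))
contractIter-Kᶜ zero    A A≡K = A≡K
contractIter-Kᶜ (suc r) {m} {s} A A≡K =
  subst (λ t → HasEntries (contractIter r m (contract A)) (Kᶜ t)) (+-suc r s)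
        (contractIter-Kᶜ r (contract A) (contract-Kᶜ A≡K))

Kᶜ-firstColumn : ∀ {k s} {A : Mat (suc (suc k)) (suc (suc k))} → HasEntries A (Kᶜ s) →
                 ∀ i → A (suc (suc i)) zero ≡ 0
Kᶜ-firstColumn {s = s} A≡K i = trans (A≡K (suc (suc i)) zero) (kEntry-+ s {suc (suc (toℕ i))} {0} (λ ()))

-- The two successor clauses expose the size of A as 2 + k, which contract needs to compute.
per-contractIter-Kᶜ : ∀ r {s} (A : Mat (r + 2) (r + 2)) → HasEntries A (Kᶜ s) → per A ≡ per (contractIter r 2 A)
per-contractIter-Kᶜ zero          A A≡K = refl
per-contractIter-Kᶜ (suc zero)    A A≡K = per-contract A (Kᶜ-firstColumn A≡K)
per-contractIter-Kᶜ (suc (suc r)) A A≡K =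
  trans (per-contract A (Kᶜ-firstColumn A≡K)) (per-contractIter-Kᶜ (suc r) (contract A) (contract-Kᶜ A≡K))

theorem2 : (m : ℕ) →
    (per (K (m + 2)) ≡ per (contractIter m 2 (K (m + 2))))
      × (per (contractIter m 2 (K (m + 2))) ≡ jl (m + 2))
theorem2 m = per-contractIter-Kᶜ m (K (m + 2)) (K-entries (m + 2)) , per-B≡jl
  where
  open ≡-Reasoning
  B : Mat 2 2
  B = contractIter m 2 (K (m + 2))
  per-B≡jl : per B ≡ jl (m + 2)
  per-B≡jl = begin
    per B                   ≡⟨ per-contract B (λ ()) ⟩
    per (contract B)        ≡⟨ per-1×1 (contract B) ⟩
    contract B zero zero    ≡⟨ contract-Kᶜ (contractIter-Kᶜ m (K (m + 2)) (K-entries (m + 2))) zero zero ⟩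
    jl (2 + (m + 0))        ≡⟨ cong (λ t → jl (2 + t)) (+-identityʳ m) ⟩
    jl (2 + m)              ≡⟨ cong jl (+-comm 2 m) ⟩
    jl (m + 2)              ∎
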